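{- Let $d\in\mathcal{D}_\Box$ and $\delta_L,\delta_R\in\mathcal{D}_\Box^*$, and consider the transition system $\mathcal{T}_{E}$ induced by the recursive specification $E=E_T\cup E_Q^\infty$. (i) If $\delta_L=\zeta_Ld_L$ for some $\zeta_L\in\mathcal{D}_\Box^*$ and $d_L\in\mathcal{D}_\Box$, then there is a deterministic internal computation from $[H^L_d\parallel Q_{\delta_R\bot\delta_L}]_{\{i,o\}}$ to $[H_{d_L}\parallel Q_{d\delta_R\bot\zeta_L}]_{\{i,o\}}$. (ii) If $\delta_L=\varepsilon$ (the empty string), then there is a deterministic internal computation from $[H^L_d\parallel Q_{\delta_R\bot\delta_L}]_{\{i,o\}}$ to $[H_\Box\parallel Q_{d\delta_R\bot}]_{\{i,o\}}$.
   Context: Process calculus. Fix a finite set $\mathcal{A}$ of actions, $\tau\notin\mathcal{A}$, $\mathcal{A}_\tau=\mathcal{A}\cup\{\tau\}$, a finite data set $\mathcal{D}$ with blank $\Box\notin\mathcal{D}$, $\mathcal{D}_\Box=\mathcal{D}\cup\{\Box\}$, two extra symbols $\bot,\$\notin\mathcal{D}_\Box$, and a finite set of channels (including $i,o$). For a set $C'$ of channels, $I_{C'}=\{c?v,c!v\mid c\in C'\}$ where $v$ ranges over the communicated values ($c?v$: receive $v$ on $c$; $c!v$: send $v$ on $c$). Process expressions: $p::=0\mid 1\mid a.p\mid p+p\mid[p\parallel p]_{C'}\mid X$ with $a$ an action or communication action, $X$ a name. A recursive specification $E$ is a set of equations $X\stackrel{def}{=}p$, at most one per name, with a defining equation for every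 name occurring in a right-hand side. Operational rules (write $p\downarrow$ for termination): $1\downarrow$; $a.p\xrightarrow{a}p$; $p+q$ has the transitions of $p$ and of $q$ and terminates if $p$ or $q$ does; $[p\parallel q]_{C'}\xrightarrow{a}[p'\parallel q]_{C'}$ if $p\xrightarrow{a}p'$ and $a\notin I_{C'}$, and symmetrically for $q$; $[p\parallel q]_{C'}\xrightarrow{\tau}[p'\parallel q']_{C'}$ if for some $c\in C'$ and value $v$, $p\xrightarrow{c?v}p'$ and $q\xrightarrow{c!v}q'$ or vice versa; $[p\parallel q]_{C'}\downarrow$ if $p\downarrow$ and $q\downarrow$; $X\xrightarrow{a}p'$ (resp. $X\downarrow$) if $(X\stackrel{def}{=}p)\in E$ and $p\xrightarrow{a}p'$ (resp. $p\downarrow$). $\mathcal{T}_E(p)$ is the transition system of expressions reachable from $p$ under these rules, with initial state $p$ and final states those $q$ with $q\downarrow$. A deterministic internal computation from $p$ to $p'$ is a sequence $p=s_1\xrightarrow{\tau}s_2\xrightarrow{\tau}\cdots\xrightarrow{\tau}s_n=p'$ such that for every $j<n$, $s_j\xrightarrow{a}s'$ implies $a=\tau$ and $s'=s_{j+1}$. Queue $E_Q^\infty$ (over $\Delta=\mathcal{D}_\Box\cup\{\bot,\$\}$): $Q_\varepsilon\stackrel{def}{=}\sum_{x\in\Delta}i?x.Q_x+1$ and, for $\sigma\in\Delta^*$, $x\in\Delta$: $Q_{\sigma x}\stackrel{def}{=}o!x.Q_\sigma+\sum_{y\in\Delta}i?y.Q_{y\sigma x}+1$. Tape controller $E_T$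 (channels $r,w,m$ to the environment): for $d\in\mathcal{D}_\Box$, $H_d\stackrel{def}{=}r!d.H_d+\sum_{e\in\mathcal{D}_\Box}w?e.H_e+m?L.H^L_d+m?R.H^R_d+1$; $H^L_d\stackrel{def}{=}i!d.\big(\sum_{e\in\mathcal{D}_\Box}o?e.H_e+o?\bot.i!\$.i!\bot.\mathit{Back}\big)$; $\mathit{Back}\stackrel{def}{=}\sum_{e\in\mathcal{D}_\Box}o?e.i!e.\mathit{Back}+o?\$.H_\Box$; $H^R_d\stackrel{def}{=}i!\$.i!d.\big(\sum_{e\in\mathcal{D}_\Box}o?e.\mathit{Fwd}_e+o?\bot.\mathit{Fwd}_\bot\big)$; $\mathit{Fwd}_d\stackrel{def}{=}\sum_{e\in\mathcal{D}_\Box}o?e.i!d.\mathit{Fwd}_e+o?\bot.i!d.\mathit{Fwd}_\bot+o?\$.H_d$; $\mathit{Fwd}_\bot\stackrel{def}{=}\sum_{e\in\mathcal{D}_\Box}o?e.i!\bot.\mathit{Fwd}_e+o?\$.i!\bot.H_\Box$. -}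

module Defs where

open import Data.Nat using (ℕ)
open import Data.Fin using (Fin)
open import Data.List using (List; []; _∷_; _++_; map; foldr; [_]; allFin)
open import Data.Empty using (⊥)
open import Data.Bool using (Bool; true; false; T)
open import Data.Product using (_×_; Σ; _,_)
open import Relation.Binary.PropositionalEquality using (_≡_)

-- The calculus is parameterised by
--   nA : number of (visible) actions,   𝒜 = Fin nA
--   nD : size of the data set,          𝒟 = Fin nD
--   nC : number of channels besides i, o, r, w, m
module Calc (nA nD nC : ℕ) where

  data DBox : Set where
    blank : DBox
    dat   : Fin nD → DBox

  data Δ : Set where
    box    : DBox → Δ
    bot    : Δ
    dollar : Δ

  -- communicated values: elements of Δ and the head movements L, R
  data Val : Set where
    val : Δ → Val
    vL  : Val
    vR  : Val

  data Chan : Set where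
    ci co cr cw cm : Chan
    other : Fin nC → Chan

  data Pre : Set where
    act : Fin nA → Pre
    rcv : Chan → Val → Pre
    snd : Chan → Val → Pre

  data Lab : Set where
    τ   : Lab
    pre : Pre → Lab

  data Name : Set where
    H    : DBox → Name
    HL   : DBox → Name
    HR   : DBox → Name
    Back : Name
    Fwd  : DBox → Name
    FwdBot : Name
    Q    : List Δ → Name      -- Q_σ, σ written left to right

  -- process expressions; a set C' of channels is given by its characteristic function
  data Proc : Set where
    𝟘    : Proc
    𝟙    : Proc
    _·_  : Pre → Proc → Proc
    _⊕_  : Proc → Proc → Proc
    par  : Proc → Proc → (Chan → Bool) → Proc
    nm   : Name → Proc

  infixr 6 _·_
  infixr 5 _⊕_

  allDBox : List DBox
  allDBox = blank ∷ map dat (allFin nD)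
  allΔ : List Δ
  allΔ = map box allDBox ++ (bot ∷ dollar ∷ [])

  Sum : {X : Set} → List X → (X → Proc) → Proc
  Sum xs f = foldr (λ x p → f x ⊕ p) 𝟘 xs

  dv : DBox → Val
  dv e = val (box e)

  lastOf : Δ → List Δ → Δ
  lastOf y []       = y
  lastOf y (z ∷ zs) = lastOf z zs

  initOf : Δ → List Δ → List Δ
  initOf y []       = []
  initOf y (z ∷ zs) = y ∷ initOf z zs

  def : Name → Proc
  def (H d) = snd cr (dv d) · nm (H d)
            ⊕ Sum allDBox (λ e → rcv cw (dv e) · nm (H e))
            ⊕ rcv cm vL · nm (HL d)
            ⊕ rcv cm vR · nm (HR d)
            ⊕ 𝟙
  def (HL d) = snd ci (dv d) ·
                 ( Sum allDBox (λ e → rcv co (dv e) · nm (H e))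
                 ⊕ rcv co (val bot) · snd ci (val dollar) · snd ci (val bot) · nm Back)
  def Back = Sum allDBox (λ e → rcv co (dv e) · snd ci (dv e) · nm Back)
           ⊕ rcv co (val dollar) · nm (H blank)
  def (HR d) = snd ci (val dollar) · snd ci (dv d) ·
                 ( Sum allDBox (λ e → rcv co (dv e) · nm (Fwd e))
                 ⊕ rcv co (val bot) · nm FwdBot)
  def (Fwd d) = Sum allDBox (λ e → rcv co (dv e) · snd ci (dv d) · nm (Fwd e))
              ⊕ rcv co (val bot) · snd ci (dv d) · nm FwdBot
              ⊕ rcv co (val dollar) · nm (H d)
  def FwdBot = Sum allDBox (λ e → rcv co (dv e) · snd ci (val bot) · nm (Fwd e))
             ⊕ rcv co (val dollar) · snd ci (val bot) · nm (H blank)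
  def (Q []) = Sum allΔ (λ x → rcv ci (val x) · nm (Q [ x ])) ⊕ 𝟙
  def (Q (y ∷ ys)) = snd co (val (lastOf y ys)) · nm (Q (initOf y ys))
                   ⊕ Sum allΔ (λ z → rcv ci (val z) · nm (Q (z ∷ y ∷ ys)))
                   ⊕ 𝟙

  data _↓ : Proc → Set where
    one↓  : 𝟙 ↓
    sumˡ↓ : ∀ {p q} → p ↓ → (p ⊕ q) ↓
    sumʳ↓ : ∀ {p q} → q ↓ → (p ⊕ q) ↓
    par↓  : ∀ {p q C} → p ↓ → q ↓ → par p q C ↓
    nm↓   : ∀ {X} → def X ↓ → nm X ↓

  InI : (Chan → Bool) → Lab → Set
  InI C τ = ⊥
  InI C (pre (act a)) = ⊥
  InI C (pre (rcv c v)) = T (C c)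
  InI C (pre (snd c v)) = T (C c)

  data _—[_]→_ : Proc → Lab → Proc → Set where
    prefix : ∀ {a p} → (a · p) —[ pre a ]→ p
    sumˡ   : ∀ {p q a p'} → p —[ a ]→ p' → (p ⊕ q) —[ a ]→ p'
    sumʳ   : ∀ {p q a q'} → q —[ a ]→ q' → (p ⊕ q) —[ a ]→ q'
    parˡ   : ∀ {p q C a p'} → p —[ a ]→ p' → (InI C a → ⊥) →
             par p q C —[ a ]→ par p' q C
    parʳ   : ∀ {p q C a q'} → q —[ a ]→ q' → (InI C a → ⊥) →
             par p q C —[ a ]→ par p q' C
    syncˡ  : ∀ {p q C p' q' c v} → T (C c) →
             p —[ pre (rcv c v) ]→ p' → q —[ pre (snd c v) ]→ q' →
             par p q C —[ τ ]→ par p' q' C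
    syncʳ  : ∀ {p q C p' q' c v} → T (C c) →
             p —[ pre (snd c v) ]→ p' → q —[ pre (rcv c v) ]→ q' →
             par p q C —[ τ ]→ par p' q' C
    unfold : ∀ {X a p'} → def X —[ a ]→ p' → nm X —[ a ]→ p'

  data DetInt : Proc → Proc → Set where
    done : ∀ {p} → DetInt p p
    step : ∀ {p s p'} → p —[ τ ]→ s →
           (∀ a s' → p —[ a ]→ s' → (a ≡ τ) × (s' ≡ s)) →
           DetInt s p' → DetInt p p'

  IO : Chan → Bool
  IO ci = true
  IO co = true
  IO _  = false

  ⟦_∥_⟧ : Proc → Proc → Proc
  ⟦ p ∥ q ⟧ = par p q IO

module Submission where

-- The controller in state H^L_d is composed with a queue holding the tape
-- contents δR ⊥ δL (rightmost symbol = front of the queue).  Every state the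
-- composition passes through has exactly one move: a handshake in which the
-- controller either pushes a value into the queue on channel i or pulls the
-- front of the queue on channel o.
-- Part (i) is then two handshakes; part (ii) is four handshakes followed by
-- the rewinding loop.

open import Defs
open import Data.Nat using (ℕ)
open import Data.List using (List; []; _∷_; _++_; map; [_])
open import Data.List.Membership.Propositional using (_∈_)
open import Data.List.Membership.Propositional.Properties using (∈-map⁺; ∈-allFin; ∈-++⁺ˡ; ∈-++⁺ʳ)
open import Data.List.Properties using (map-++; ++-assoc; ∷ʳ-injective)
open import Data.List.Relation.Unary.Any using (here; there)
open import Data.List.Reverse using (Reverse; []; _∶_∶ʳ_; reverseView)
open import Data.Product using (_×_; Σ; _,_)
open import Data.Unit using (tt)
open import Data.Empty using (⊥-elim)
open import Relation.Binary.PropositionalEquality using (_≡_; refl; sym; trans; cong; subst₂)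

module LeftMove (nA nD nC : ℕ) where
  open Calc nA nD nC

  sum-intro : {X : Set} (xs : List X) (f : X → Proc) {x : X} {a : Lab} {s : Proc} →
              x ∈ xs → f x —[ a ]→ s → Sum xs f —[ a ]→ s
  sum-intro (_ ∷ _)  f (here refl) t = sumˡ t
  sum-intro (_ ∷ xs) f (there x∈xs) t = sumʳ (sum-intro xs f x∈xs t)

  sum-inv : {X : Set} (xs : List X) (f : X → Proc) {a : Lab} {s : Proc} →
            Sum xs f —[ a ]→ s → Σ X λ x → f x —[ a ]→ s
  sum-inv (y ∷ _)  f (sumˡ t) = y , t
  sum-inv (_ ∷ xs) f (sumʳ t) = sum-inv xs f t

  ∈-allDBox : (e : DBox) → e ∈ allDBox
  ∈-allDBox blank   = here refl
  ∈-allDBox (dat k) = there (∈-map⁺ dat (∈-allFin k))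

  ∈-allΔ : (x : Δ) → x ∈ allΔ
  ∈-allΔ (box e) = ∈-++⁺ˡ (∈-map⁺ box (∈-allDBox e))
  ∈-allΔ bot     = ∈-++⁺ʳ (map box allDBox) (here refl)
  ∈-allΔ dollar  = ∈-++⁺ʳ (map box allDBox) (there (here refl))

  ⟨_∣_⟩ : Proc → List Δ → Proc
  ⟨ p ∣ l ⟩ = ⟦ p ∥ nm (Q l) ⟧

  -- Q's equation splits a nonempty string as σ x via initOf / lastOf.
  init-last : (y : Δ) (ys : List Δ) → y ∷ ys ≡ initOf y ys ++ [ lastOf y ys ]
  init-last y []       = refl
  init-last y (z ∷ zs) = cong (y ∷_) (init-last z zs)

  data QueueStep (l : List Δ) : Lab → Proc → Set where
    enqueue : (z : Δ) → QueueStep l (pre (rcv ci (val z))) (nm (Q (z ∷ l)))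
    dequeue : (u : List Δ) (x : Δ) → l ≡ u ++ [ x ] →
              QueueStep l (pre (snd co (val x))) (nm (Q u))

  queue-inv : (l : List Δ) {a : Lab} {s : Proc} → nm (Q l) —[ a ]→ s → QueueStep l a s
  queue-inv [] (unfold (sumˡ t)) with sum-inv allΔ _ t
  ... | z , prefix = enqueue z
  queue-inv [] (unfold (sumʳ ()))
  queue-inv (y ∷ ys) (unfold (sumˡ prefix)) = dequeue (initOf y ys) (lastOf y ys) (init-last y ys)
  queue-inv (y ∷ ys) (unfold (sumʳ (sumˡ t))) with sum-inv allΔ _ t
  ... | z , prefix = enqueue z
  queue-inv (y ∷ ys) (unfold (sumʳ (sumʳ ())))

  -- Hence the queue never moves on its own next to a controller on {i, o}.
  queue-on-io : {l : List Δ} {a : Lab} {s : Proc} → nm (Q l) —[ a ]→ s → InI IO a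
  queue-on-io {l} t with queue-inv l t
  ... | enqueue _     = tt
  ... | dequeue _ _ _ = tt

  dequeue-unique : (u : List Δ) (x : Δ) {y : Δ} {s : Proc} →
                   nm (Q (u ++ [ x ])) —[ pre (snd co (val y)) ]→ s → (y ≡ x) × (s ≡ nm (Q u))
  dequeue-unique u x t with queue-inv (u ++ [ x ]) t
  ... | dequeue u′ y eq with ∷ʳ-injective u u′ eq
  ...   | refl , refl = refl , refl

  enqueue-step : (l : List Δ) (z : Δ) → nm (Q l) —[ pre (rcv ci (val z)) ]→ nm (Q (z ∷ l))
  enqueue-step []      z = unfold (sumˡ (sum-intro allΔ _ (∈-allΔ z) prefix))
  enqueue-step (_ ∷ _) z = unfold (sumʳ (sumˡ (sum-intro allΔ _ (∈-allΔ z) prefix)))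

  dequeue-step : (u : List Δ) (x : Δ) → nm (Q (u ++ [ x ])) —[ pre (snd co (val x)) ]→ nm (Q u)
  dequeue-step []       x = unfold (sumˡ prefix)
  dequeue-step (w ∷ ws) x with ∷ʳ-injective (w ∷ ws) _ (init-last w (ws ++ [ x ]))
  ... | u≡init , x≡last =
    subst₂ (λ v l → nm (Q (w ∷ ws ++ [ x ])) —[ pre (snd co (val v)) ]→ nm (Q l))
           (sym x≡last) (sym u≡init) (unfold (sumˡ prefix))

  OnlySends : Proc → Δ → Proc → Set
  OnlySends p v p′ = ∀ {a s} → p —[ a ]→ s → (a ≡ pre (snd ci (val v))) × (s ≡ p′)

  OnlyReceives : Proc → (Δ → Proc) → Set
  OnlyReceives p k = ∀ {a s} → p —[ a ]→ s → Σ Δ λ x → (a ≡ pre (rcv co (val x))) × (s ≡ k x)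

  put-step : {p p′ : Proc} {v : Δ} (l : List Δ) → OnlySends p v p′ →
             p —[ pre (snd ci (val v)) ]→ p′ → DetInt ⟨ p ∣ l ⟩ ⟨ p′ ∣ v ∷ l ⟩
  put-step {p} {p′} {v} l only t = step (syncʳ tt t (enqueue-step l v)) unique done
    where
    unique : ∀ a s → ⟨ p ∣ l ⟩ —[ a ]→ s → (a ≡ τ) × (s ≡ ⟨ p′ ∣ v ∷ l ⟩)
    unique a s (parˡ t′ blocked) with only t′
    ... | refl , _ = ⊥-elim (blocked tt)
    unique a s (parʳ t′ blocked) = ⊥-elim (blocked (queue-on-io t′))
    unique a s (syncˡ _ t′ _) with only t′
    ... | () , _
    unique a s (syncʳ _ t′ t″) with only t′
    ... | refl , refl with queue-inv l t″
    ...   | enqueue _ = refl , refl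

  get-step : {p : Proc} {k : Δ → Proc} (u : List Δ) (x : Δ) → OnlyReceives p k →
             p —[ pre (rcv co (val x)) ]→ k x → DetInt ⟨ p ∣ u ++ [ x ] ⟩ ⟨ k x ∣ u ⟩
  get-step {p} {k} u x only t = step (syncˡ tt t (dequeue-step u x)) unique done
    where
    unique : ∀ a s → ⟨ p ∣ u ++ [ x ] ⟩ —[ a ]→ s → (a ≡ τ) × (s ≡ ⟨ k x ∣ u ⟩)
    unique a s (parˡ t′ blocked) with only t′
    ... | _ , refl , _ = ⊥-elim (blocked tt)
    unique a s (parʳ t′ blocked) = ⊥-elim (blocked (queue-on-io t′))
    unique a s (syncˡ _ t′ t″) with only t′
    ... | _ , refl , refl with dequeue-unique u x t″
    ...   | refl , refl = refl , refl
    unique a s (syncʳ _ t′ _) with only t′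
    ... | _ , () , _

  infixr 4 _⨾_
  _⨾_ : {p q r : Proc} → DetInt p q → DetInt q r → DetInt p r
  done            ⨾ rest = rest
  step t unique d ⨾ rest = step t unique (d ⨾ rest)

  from-queue : {p r : Proc} {l m : List Δ} → l ≡ m → DetInt ⟨ p ∣ m ⟩ r → DetInt ⟨ p ∣ l ⟩ r
  from-queue refl d = d

  to-queue : {p s : Proc} {l m : List Δ} → l ≡ m → DetInt s ⟨ p ∣ l ⟩ → DetInt s ⟨ p ∣ m ⟩
  to-queue refl d = d

  send-only : (v : Δ) (q : Proc) → OnlySends (snd ci (val v) · q) v q
  send-only v q prefix = refl , refl

  await : Proc
  await = Sum allDBox (λ e → rcv co (dv e) · nm (H e))
        ⊕ rcv co (val bot) · snd ci (val dollar) · snd ci (val bot) · nm Back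

  HL-sends : (d : DBox) → OnlySends (nm (HL d)) (box d) await
  HL-sends d (unfold prefix) = refl , refl

  after-await : Δ → Proc
  after-await (box e) = nm (H e)
  after-await bot     = snd ci (val dollar) · snd ci (val bot) · nm Back
  after-await dollar  = 𝟘

  await-receives : OnlyReceives await after-await
  await-receives (sumˡ t) with sum-inv allDBox _ t
  ... | e , prefix = box e , refl , refl
  await-receives (sumʳ prefix) = bot , refl , refl

  await-box : (e : DBox) → await —[ pre (rcv co (dv e)) ]→ nm (H e)
  await-box e = sumˡ (sum-intro allDBox _ (∈-allDBox e) prefix)

  after-back : Δ → Proc
  after-back (box e) = snd ci (dv e) · nm Back
  after-back bot     = 𝟘
  after-back dollar  = nm (H blank)

  back-receives : OnlyReceives (nm Back) after-back
  back-receives (unfold (sumˡ t)) with sum-inv allDBox _ t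
  ... | e , prefix = box e , refl , refl
  back-receives (unfold (sumʳ prefix)) = dollar , refl , refl

  back-box : (e : DBox) → nm Back —[ pre (rcv co (dv e)) ]→ after-back (box e)
  back-box e = unfold (sumˡ (sum-intro allDBox _ (∈-allDBox e) prefix))

  -- Back cycles the tape symbols ws behind the marker $ to the far side of u,
  -- one dequeue/enqueue pair per symbol, and stops in H_□ on reading $.
  rewind : {ws : List DBox} → Reverse ws → (u : List Δ) →
           DetInt ⟨ nm Back ∣ u ++ dollar ∷ map box ws ⟩ ⟨ nm (H blank) ∣ map box ws ++ u ⟩
  rewind [] u = get-step u dollar back-receives (unfold (sumʳ prefix))
  rewind (xs ∶ rs ∶ʳ e) u =
    from-queue cycled
      (get-step (u ++ dollar ∷ map box xs) (box e) back-receives (back-box e)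
       ⨾ put-step _ (send-only (box e) (nm Back)) prefix
       ⨾ to-queue rewound (rewind rs (box e ∷ u)))
    where
    cycled : u ++ dollar ∷ map box (xs ++ [ e ]) ≡ (u ++ dollar ∷ map box xs) ++ [ box e ]
    cycled = trans (cong (λ z → u ++ dollar ∷ z) (map-++ box xs [ e ]))
                   (sym (++-assoc u (dollar ∷ map box xs) [ box e ]))
    rewound : map box xs ++ box e ∷ u ≡ map box (xs ++ [ e ]) ++ u
    rewound = trans (sym (++-assoc (map box xs) [ box e ] u))
                    (cong (_++ u) (sym (map-++ box xs [ e ])))

  move-left-inner : (d : DBox) (δR ζL : List DBox) (dL : DBox) →
    DetInt ⟨ nm (HL d) ∣ map box δR ++ bot ∷ map box (ζL ++ [ dL ]) ⟩
           ⟨ nm (H dL) ∣ box d ∷ map box δR ++ bot ∷ map box ζL ⟩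
  move-left-inner d δR ζL dL =
    from-queue split-last
      (put-step _ (HL-sends d) (unfold prefix)
       ⨾ get-step (box d ∷ tape) (box dL) await-receives (await-box dL))
    where
    tape : List Δ
    tape = map box δR ++ bot ∷ map box ζL
    split-last : map box δR ++ bot ∷ map box (ζL ++ [ dL ]) ≡ tape ++ [ box dL ]
    split-last = trans (cong (λ z → map box δR ++ bot ∷ z) (map-++ box ζL [ dL ]))
                       (sym (++-assoc (map box δR) (bot ∷ map box ζL) [ box dL ]))

  move-left-edge : (d : DBox) (δR : List DBox) →
    DetInt ⟨ nm (HL d) ∣ map box δR ++ [ bot ] ⟩
           ⟨ nm (H blank) ∣ box d ∷ map box δR ++ [ bot ] ⟩
  move-left-edge d δR =
    put-step _ (HL-sends d) (unfold prefix)
    ⨾ get-step (box d ∷ map box δR) bot await-receives (sumʳ prefix)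
    ⨾ put-step _ (send-only dollar _) prefix
    ⨾ put-step _ (send-only bot _) prefix
    ⨾ rewind (reverseView (d ∷ δR)) [ bot ]

lemma2 : (nA nD nC : ℕ) → let open Calc nA nD nC in
    (d : DBox) (δL δR : List DBox) →
    ((ζL : List DBox) (dL : DBox) → δL ≡ ζL ++ [ dL ] →
      DetInt ⟦ nm (HL d) ∥ nm (Q (map box δR ++ bot ∷ map box δL)) ⟧
             ⟦ nm (H dL) ∥ nm (Q (box d ∷ map box δR ++ bot ∷ map box ζL)) ⟧)
    × (δL ≡ [] →
      DetInt ⟦ nm (HL d) ∥ nm (Q (map box δR ++ bot ∷ map box δL)) ⟧
             ⟦ nm (H blank) ∥ nm (Q (box d ∷ map box δR ++ bot ∷ [])) ⟧)
lemma2 nA nD nC d δL δR =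
  (λ { ζL dL refl → move-left-inner d δR ζL dL }) , (λ { refl → move-left-edge d δR })
  where open LeftMove nA nD nC
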